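{- Let $\sigma$ be a separable permutation of size $k$, let $T_\sigma$ be a binary separating tree of $\sigma$, and let $\tau$ be a permutation of size $n$. Algorithm 1 (described in the context) run on $(T_\sigma,\tau)$ outputs a longest common pattern of $\sigma$ and $\tau$, i.e. a permutation $\pi$ of maximal size that is a pattern of both $\sigma$ and $\tau$.
   Context: A permutation $\pi$ of size $m$ is a pattern of $\sigma$ if there are indices $i_1<\dots<i_m$ with $\sigma_{i_\ell}<\sigma_{i_r}$ iff $\pi_\ell<\pi_r$. $\sigma$ is separable if it contains neither $3142$ nor $2413$. A binary separating tree of $\sigma$ is a binary ordered tree with $k$ leaves, internal nodes labeled $+$ or $-$, such that, decorating each node $V$ by the subsequence $\sigma(V)$ of $\sigma$ formed by the leaves below $V$ (leaves read $\sigma_1,\dots,\sigma_k$ from left to right), each $\sigma(V)$ is a permutation of an interval of integers and, for an internal node $V$ with left child $V_L$ and right child $V_R$, all values of $\sigma(V_L)$ are smaller than all values of $\sigma(V_R)$ if $V$ is labeled $+$ and larger if $V$ is labeled $-$. Below, $\sigma(V)$ is identified with the pattern (permutation of $\{1,\dots,|\sigma(V)|\}$) it is order-isomorphic to. Separable permutations are exactly those having a binary separating tree. Concatenations: for patterns $\pi$ of size $p$ and $\pi'$ of size $p'$, $\pi\oplus\pi'=\pi_1\cdots\pi_p(\pi'_1+p)\cdots(\pi'_{p'}+p)$ and $\pi\ominus\pi'=(\pi_1+p')\cdots(\pi_p+p')\pi'_1\cdots\pi'_{p'}$. $\epsilon$ denotes the empty pattern. For a finite set $S$ of patterns, $Longest(S)$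 is an element of $S$ of maximal size (e.g. the lexicographically smallest among those). Algorithm 1: it fills an array $M(V,i,j,a,b)$, $V$ a node of $T_\sigma$, $i,j,a,b$ integers, all entries initialized to $\epsilon$ (entries with $i>j$, $a>b$, or indices outside $\{1,\dots,n\}$ are $\epsilon$). For each leaf $V$ and $1\le i\le j\le n$, $1\le a\le b\le n$: $M(V,i,j,a,b)$ is the pattern $1$ if some $h\in\{i,\dots,j\}$ has $a\le\tau_h\le b$, otherwise $\epsilon$. Then for internal nodes $V$ in postfix order, with left child $V_L$ and right child $V_R$, and for all $1\le i\le j\le n$, $1\le a\le b\le n$: if $V$ is labeled $+$, $M(V,i,j,a,b)=Longest\{M(V_L,i,h-1,a,c-1)\oplus M(V_R,h,j,c,b): i\le h\le j+1,\ a\le c\le b+1\}$; if $V$ is labeled $-$, $M(V,i,j,a,b)=Longest\{M(V_L,i,h-1,c,b)\ominus M(V_R,h,j,a,c-1): i\le h\le j+1,\ a\le c\le b+1\}$. The output is $M(\text{root},1,n,1,n)$. -}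

module Defs where

open import Data.Nat using (ℕ; zero; suc; _+_; _∸_; _≤_; _<_; _≤ᵇ_)
open import Data.Bool using (Bool; true; false; if_then_else_; _∧_; _∨_)
open import Data.List using (List; []; _∷_; length; map; upTo; concatMap; _++_)
open import Data.Bool.ListAction using (any)
open import Data.List.Membership.Propositional using (_∈_)
open import Data.List.Relation.Binary.Sublist.Propositional using (_⊆_)
open import Data.List.Relation.Binary.Permutation.Propositional using (_↭_)
open import Data.Product using (Σ; ∃; _×_; _,_)
open import Relation.Binary.PropositionalEquality using (_≡_)
open import Relation.Nullary using (¬_)
open import Function.Bundles using (_⇔_)

-- A pattern / permutation is a list of natural numbers (one-line notation).
Pattern : Set
Pattern = List ℕ

ε : Pattern
ε = []

-- [lo .. hi] (empty if hi < lo)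
range : ℕ → ℕ → List ℕ
range lo hi = map (lo +_) (upTo (suc hi ∸ lo))

IsPerm : Pattern → Set
IsPerm π = π ↭ range 1 (length π)

-- 1-based access σ_i (0 outside the range; only used on valid indices)
at : List ℕ → ℕ → ℕ
at []       _             = 0
at (x ∷ xs) 0             = 0
at (x ∷ xs) 1             = x
at (x ∷ xs) (suc (suc i)) = at xs (suc i)

OrderIso : List ℕ → Pattern → Set
OrderIso s π = length s ≡ length π ×
  (∀ l r → 1 ≤ l → l ≤ length π → 1 ≤ r → r ≤ length π →
     (at s l < at s r) ⇔ (at π l < at π r))

IsPatternOf : Pattern → List ℕ → Set
IsPatternOf π σ = ∃ λ s → (s ⊆ σ) × OrderIso s π

Separable : List ℕ → Set
Separable σ = ¬ IsPatternOf (3 ∷ 1 ∷ 4 ∷ 2 ∷ []) σ × ¬ IsPatternOf (2 ∷ 4 ∷ 1 ∷ 3 ∷ []) σ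

_⊕_ : Pattern → Pattern → Pattern
π ⊕ π' = π ++ map (_+ length π) π'

_⊖_ : Pattern → Pattern → Pattern
π ⊖ π' = map (_+ length π') π ++ π'

data Sign : Set where
  plus minus : Sign

data Tree : Set where
  leaf : Tree
  node : Sign → Tree → Tree → Tree

IsIntervalPerm : List ℕ → Set
IsIntervalPerm s = ∃ λ lo → s ↭ range lo (lo + length s ∸ 1)

AllLess : List ℕ → List ℕ → Set
AllLess xs ys = ∀ x y → x ∈ xs → y ∈ ys → x < y

-- SepTreeFor T s : T is a binary separating tree whose leaves, read from
-- left to right, carry the sequence s (so s = σ(root)).
SepTreeFor : Tree → List ℕ → Set
SepTreeFor leaf s = length s ≡ 1
SepTreeFor (node sg L R) s =
  ∃ λ sL → ∃ λ sR → (s ≡ sL ++ sR) × SepTreeFor L sL × SepTreeFor R sR ×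
    IsIntervalPerm s × signCond sg sL sR
  where
  signCond : Sign → List ℕ → List ℕ → Set
  signCond plus  a b = AllLess a b
  signCond minus a b = AllLess b a

IsSeparatingTree : Tree → List ℕ → Set
IsSeparatingTree T σ = SepTreeFor T σ

LongestSpec : (List Pattern → Pattern) → Set
LongestSpec Lg = ∀ (S : List Pattern) → ¬ (S ≡ []) →
  (Lg S ∈ S) × (∀ π → π ∈ S → length π ≤ length (Lg S))

module Algorithm1 (Lg : List Pattern → Pattern) (τ : List ℕ) where

  n : ℕ
  n = length τ

  valid : ℕ → ℕ → ℕ → ℕ → Bool
  valid i j a b = (1 ≤ᵇ i) ∧ (i ≤ᵇ j) ∧ (j ≤ᵇ n) ∧ (1 ≤ᵇ a) ∧ (a ≤ᵇ b) ∧ (b ≤ᵇ n)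

  M : Tree → ℕ → ℕ → ℕ → ℕ → Pattern
  M leaf i j a b =
    if valid i j a b
    then (if any (λ h → (a ≤ᵇ at τ h) ∧ (at τ h ≤ᵇ b)) (range i j) then 1 ∷ [] else ε)
    else ε
  M (node plus L R) i j a b =
    if valid i j a b
    then Lg (concatMap (λ h → map (λ c → M L i (h ∸ 1) a (c ∸ 1) ⊕ M R h j c b)
                                  (range a (suc b)))
                       (range i (suc j)))
    else ε
  M (node minus L R) i j a b =
    if valid i j a b
    then Lg (concatMap (λ h → map (λ c → M L i (h ∸ 1) c b ⊖ M R h j a (c ∸ 1))
                                  (range a (suc b)))
                       (range i (suc j)))
    else ε

  output : Tree → Pattern
  output T = M T 1 n 1 n

algorithm1 : (List Pattern → Pattern) → Tree → List ℕ → Pattern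
algorithm1 Lg T τ = Algorithm1.output Lg τ T

IsLongestCommonPattern : Pattern → List ℕ → List ℕ → Set
IsLongestCommonPattern π σ τ =
  IsPerm π × IsPatternOf π σ × IsPatternOf π τ ×
  (∀ π' → IsPerm π' → IsPatternOf π' σ → IsPatternOf π' τ → length π' ≤ length π)

-- By induction on the separating tree, M(V,i,j,a,b) is a longest common pattern of σ(V) and of
-- the part of τ with positions in [i,j] and values in [a,b].  It is a common pattern because the two
-- halves of the chosen candidate occur in sub-boxes separated in position and, upwards for + and
-- downwards for −, in value, so the concatenated occurrences form an occurrence of their ⊕ (or ⊖).
-- It is longest because a common occurrence of σ(V) = σ(V_L)σ(V_R) and the box splits accordingly:
-- cutting the box just after the last position of the left part and just above the largest value of
-- the lower part gives a split point (h, c) that the algorithm tries, and induction bounds both parts.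

{-# OPTIONS --safe #-}
module Submission where

open import Defs
open import Data.Bool using (Bool; true; false; T; if_then_else_; _∧_)
open import Data.Bool.ListAction using (any)
open import Data.Bool.Properties using (T-≡; T-∧)
open import Data.Empty using (⊥-elim)
open import Data.List using (List; []; _∷_; length; map; upTo; applyUpTo; concatMap; _++_)
open import Data.List.Extrema.Nat using (max; max≤v⁺; v≤max⁺; xs≤max)
open import Data.List.Membership.Propositional using (_∈_; find; lose)
open import Data.List.Membership.Propositional.Properties
  using (∈-map⁺; ∈-map⁻; ∈-upTo⁺; ∈-upTo⁻; ∈-concatMap⁺; ∈-concatMap⁻)
open import Data.List.Properties using (map-++; length-++; length-map; map-∘; map-cong; map-upTo; ∷-injective)
open import Data.List.Relation.Binary.Permutation.Propositional using (_↭_; ↭-refl; module PermutationReasoning)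
import Data.List.Relation.Binary.Permutation.Propositional.Properties as Perm
open import Data.List.Relation.Binary.Pointwise as Pointwise using (Pointwise; []; _∷_)
open import Data.List.Relation.Binary.Sublist.Propositional using (_⊆_; []; _∷_; _∷ʳ_; minimum; ⊆-refl)
import Data.List.Relation.Binary.Sublist.Propositional.Properties as Sublist
open import Data.List.Relation.Unary.All as All using (All; []; _∷_)
import Data.List.Relation.Unary.All.Properties as All
open import Data.List.Relation.Unary.AllPairs as AllPairs using (AllPairs; []; _∷_)
import Data.List.Relation.Unary.AllPairs.Properties as AllPairsₚ
open import Data.List.Relation.Unary.Any using (here; there)
open import Data.List.Relation.Unary.Any.Properties using (any⁺; any⁻)
open import Data.Nat using (ℕ; zero; suc; _+_; _∸_; _≤_; _<_; _≤ᵇ_; z≤n; s≤s; z<s; s<s; s≤s⁻¹; s<s⁻¹)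
open import Data.Nat.Properties
open import Data.Product using (∃; ∃₂; _×_; _,_; proj₁; proj₂)
open import Data.Sum using (inj₁)
open import Function using (_∘_; _⇔_; mk⇔; Equivalence)
import Function.Properties.Equivalence as FP
open import Relation.Binary.PropositionalEquality
  using (_≡_; refl; sym; trans; cong; cong₂; subst; module ≡-Reasoning)
open import Relation.Nullary using (¬_)

private variable
  A B : Set
  x y z lo hi : ℕ
  xs ys zs : List ℕ

infix 4 _∈[_,_]
_∈[_,_] : ℕ → ℕ → ℕ → Set
x ∈[ lo , hi ] = lo ≤ x × x ≤ hi

<∸⇒+< : ∀ lo {m d} → d < m ∸ lo → lo + d < m
<∸⇒+< zero             d<m = d<m
<∸⇒+< (suc lo) {suc m} d<m = s<s (<∸⇒+< lo d<m)

∈-range⁺ : x ∈[ lo , hi ] → x ∈ range lo hi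
∈-range⁺ {x} {lo} {hi} (lo≤x , x≤hi) =
  subst (_∈ range lo hi) (m+[n∸m]≡n lo≤x) (∈-map⁺ (lo +_) (∈-upTo⁺ (∸-monoˡ-< (s≤s x≤hi) lo≤x)))

∈-range⁻ : x ∈ range lo hi → x ∈[ lo , hi ]
∈-range⁻ {lo = lo} x∈ with d , d∈ , refl ← ∈-map⁻ (lo +_) x∈ = m≤m+n lo d , s≤s⁻¹ (<∸⇒+< lo (∈-upTo⁻ d∈))

<⇒≤∸1 : ∀ {c} → x < c → x ≤ c ∸ 1
<⇒≤∸1 (s≤s x≤c) = x≤c

≤∸1⇒< : ∀ {c} → 1 ≤ c → x ≤ c ∸ 1 → x < c
≤∸1⇒< {c = suc _} _ = s≤s

join-interval : ∀ {c} → 1 ≤ lo → c ∈[ lo , suc hi ] → All (_∈[ lo , c ∸ 1 ]) xs → All (_∈[ c , hi ]) ys →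
                All (_∈[ lo , hi ]) xs × All (_∈[ lo , hi ]) ys × AllLess xs ys
join-interval 1≤lo (lo≤c , c≤1+hi) xs∈ ys∈ =
    All.map (λ (lo≤x , x≤c-1) → lo≤x , ≤-trans x≤c-1 (∸-monoˡ-≤ 1 c≤1+hi)) xs∈
  , All.map (λ (c≤y , y≤hi) → ≤-trans lo≤c c≤y , y≤hi) ys∈
  , λ _ _ x∈ y∈ → <-≤-trans (≤∸1⇒< (≤-trans 1≤lo lo≤c) (proj₂ (All.lookup xs∈ x∈)))
                            (proj₁ (All.lookup ys∈ y∈))

cut-interval : lo ≤ suc hi → All (_∈[ lo , hi ]) xs → All (_∈[ lo , hi ]) ys → AllLess xs ys →
               ∃ λ c → c ∈[ lo , suc hi ] × All (_∈[ lo , c ∸ 1 ]) xs × All (_∈[ c , hi ]) ys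
cut-interval {lo} {xs = xs} lo≤1+hi xs∈ ys∈ xs<ys =
    c
  , (v≤max⁺ lo (map suc xs) (inj₁ ≤-refl) , max≤v⁺ lo≤1+hi (All.map⁺ (All.map (s≤s ∘ proj₂) xs∈)))
  , All.tabulate (λ x∈ → proj₁ (All.lookup xs∈ x∈) , <⇒≤∸1 (All.lookup xs<c x∈))
  , All.tabulate (λ y∈ → max≤v⁺ (proj₁ (All.lookup ys∈ y∈)) (All.map⁺ (All.tabulate (λ x∈ → xs<ys _ _ x∈ y∈)))
                      , proj₂ (All.lookup ys∈ y∈))
  where
  c = max lo (map suc xs)
  xs<c : All (_< c) xs
  xs<c = All.map⁻ (xs≤max lo (map suc xs))

∈⇒≢[] : ∀ {x : A} {xs} → x ∈ xs → ¬ xs ≡ []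
∈⇒≢[] (here _)  ()
∈⇒≢[] (there _) ()

⊆-++⁻ : ∀ {u : List A} xs ys → u ⊆ xs ++ ys → ∃₂ λ u₁ u₂ → u ≡ u₁ ++ u₂ × u₁ ⊆ xs × u₂ ⊆ ys
⊆-++⁻ []       ys u⊆            = [] , _ , refl , [] , u⊆
⊆-++⁻ (x ∷ xs) ys (.x ∷ʳ u⊆) with u₁ , u₂ , refl , u₁⊆ , u₂⊆ ← ⊆-++⁻ xs ys u⊆ =
  u₁ , u₂ , refl , x ∷ʳ u₁⊆ , u₂⊆
⊆-++⁻ (x ∷ xs) ys (refl ∷ u⊆) with u₁ , u₂ , refl , u₁⊆ , u₂⊆ ← ⊆-++⁻ xs ys u⊆ =
  x ∷ u₁ , u₂ , refl , refl ∷ u₁⊆ , u₂⊆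

⊆-map⁻ : ∀ (f : A → B) {s} zs → s ⊆ map f zs → ∃ λ ps → ps ⊆ zs × map f ps ≡ s
⊆-map⁻ f []       []          = [] , [] , refl
⊆-map⁻ f (z ∷ zs) (_ ∷ʳ s⊆)  with ps , ps⊆ , refl ← ⊆-map⁻ f zs s⊆ = ps , z ∷ʳ ps⊆ , refl
⊆-map⁻ f (z ∷ zs) (refl ∷ s⊆) with ps , ps⊆ , refl ← ⊆-map⁻ f zs s⊆ = z ∷ ps , refl ∷ ps⊆ , refl

map-++⁻ : ∀ (f : A → B) xs ys {zs} → map f xs ≡ ys ++ zs →
          ∃₂ λ xs₁ xs₂ → xs ≡ xs₁ ++ xs₂ × map f xs₁ ≡ ys × map f xs₂ ≡ zs
map-++⁻ f xs       []       eq = [] , xs , refl , refl , eq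
map-++⁻ f (x ∷ xs) (_ ∷ ys) eq with refl , eq′ ← ∷-injective eq
                              with xs₁ , xs₂ , refl , refl , refl ← map-++⁻ f xs ys eq′ =
  x ∷ xs₁ , xs₂ , refl , refl , refl

AllLess-⊆ : ∀ {xs ys xs′ ys′} → AllLess xs ys → xs′ ⊆ xs → ys′ ⊆ ys → AllLess xs′ ys′
AllLess-⊆ xs<ys xs′⊆ ys′⊆ x y x∈ y∈ = xs<ys x y (Sublist.Any-resp-⊆ xs′⊆ x∈) (Sublist.Any-resp-⊆ ys′⊆ y∈)

module _ {R : A → B → Set} where

  pointwise-universal : ∀ {xs ys} → length xs ≡ length ys → (∀ {x y} → x ∈ xs → y ∈ ys → R x y) →
                        Pointwise R xs ys
  pointwise-universal {[]}    {[]}    _  _ = []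
  pointwise-universal {_ ∷ _} {_ ∷ _} eq r =
    r (here refl) (here refl) ∷ pointwise-universal (suc-injective eq) (λ x∈ y∈ → r (there x∈) (there y∈))

  pointwise-partner : ∀ {xs ys y} → Pointwise R xs ys → y ∈ ys → ∃ λ x → x ∈ xs × R x y
  pointwise-partner (r ∷ _)  (here refl) = _ , here refl , r
  pointwise-partner (_ ∷ rs) (there y∈) with x , x∈ , r ← pointwise-partner rs y∈ = x , there x∈ , r

  pointwise-++⁻ : ∀ {xs ys xs′ ys′} → length xs ≡ length ys → Pointwise R (xs ++ xs′) (ys ++ ys′) →
                  Pointwise R xs ys × Pointwise R xs′ ys′
  pointwise-++⁻ {[]}    {[]}    _  rs       = [] , rs
  pointwise-++⁻ {_ ∷ _} {_ ∷ _} eq (r ∷ rs) =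
    let rs₁ , rs₂ = pointwise-++⁻ (suc-injective eq) rs in r ∷ rs₁ , rs₂

module _ {R : ℕ → ℕ → Set} where

  pointwise-at⁺ : ∀ {xs ys r} → Pointwise R xs ys → r < length ys → R (at xs (suc r)) (at ys (suc r))
  pointwise-at⁺ {r = zero}  (ρ ∷ _)  _   = ρ
  pointwise-at⁺ {r = suc r} (_ ∷ ρs) r<n = pointwise-at⁺ ρs (s<s⁻¹ r<n)

  pointwise-at⁻ : ∀ {xs ys} → length xs ≡ length ys →
                  (∀ r → r < length ys → R (at xs (suc r)) (at ys (suc r))) → Pointwise R xs ys
  pointwise-at⁻ {[]}    {[]}    _  _ = []
  pointwise-at⁻ {_ ∷ _} {_ ∷ _} eq ρ =
    ρ 0 z<s ∷ pointwise-at⁻ (suc-injective eq) (λ r r<n → ρ (suc r) (s<s r<n))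

Increasing : List ℕ → Set
Increasing = AllPairs _<_

Increasing-++⁺ : Increasing xs → Increasing ys → AllLess xs ys → Increasing (xs ++ ys)
Increasing-++⁺ xs↑ ys↑ xs<ys =
  AllPairsₚ.++⁺ xs↑ ys↑ (All.tabulate λ x∈ → All.tabulate λ y∈ → xs<ys _ _ x∈ y∈)

Increasing-++⁻ : ∀ xs → Increasing (xs ++ ys) → Increasing xs × Increasing ys × AllLess xs ys
Increasing-++⁻ []       ys↑        = [] , ys↑ , λ _ _ ()
Increasing-++⁻ (x ∷ xs) (x< ∷ ↑) with xs↑ , ys↑ , xs<ys ← Increasing-++⁻ xs ↑ =
  All.++⁻ˡ xs x< ∷ xs↑ , ys↑ , λ where
    _ _ (here refl) y∈ → All.lookup (All.++⁻ʳ xs x<) y∈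
    _ _ (there x∈)  y∈ → xs<ys _ _ x∈ y∈

Increasing-⊆ : xs ⊆ ys → Increasing ys → Increasing xs
Increasing-⊆ []          []         = []
Increasing-⊆ (_ ∷ʳ xs⊆)  (_ ∷ ys↑)  = Increasing-⊆ xs⊆ ys↑
Increasing-⊆ (refl ∷ xs⊆) (y< ∷ ys↑) = Sublist.All-resp-⊆ xs⊆ y< ∷ Increasing-⊆ xs⊆ ys↑

∈-∷⁻ : y ∈ z ∷ zs → z < y → y ∈ zs
∈-∷⁻ (here refl) z<z = ⊥-elim (<-irrefl refl z<z)
∈-∷⁻ (there y∈)  _   = y∈

Increasing⇒⊆ : Increasing xs → Increasing zs → All (_∈ zs) xs → xs ⊆ zs
Increasing⇒⊆ []          _          []                = minimum _
Increasing⇒⊆ (x< ∷ xs↑) (z< ∷ zs↑) (here refl ∷ xs∈) =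
  refl ∷ Increasing⇒⊆ xs↑ zs↑ (All.zipWith (λ (y∈ , x<y) → ∈-∷⁻ y∈ x<y) (xs∈ , x<))
Increasing⇒⊆ (x< ∷ xs↑) (z< ∷ zs↑) (there x∈ ∷ xs∈) =
  _ ∷ʳ Increasing⇒⊆ (x< ∷ xs↑) zs↑ (x∈ ∷ All.zipWith (λ (y∈ , x<y) → ∈-∷⁻ y∈ (<-trans z<x x<y)) (xs∈ , x<))
  where
  z<x = All.lookup z< x∈

Increasing-range : ∀ lo hi → Increasing (range lo hi)
Increasing-range lo hi = AllPairsₚ.map⁺
  (AllPairs.map (+-monoʳ-< lo) (AllPairsₚ.applyUpTo⁺₁ (λ d → d) (suc hi ∸ lo) (λ d<e _ → d<e)))

Concordant : ℕ → ℕ → ℕ → ℕ → Set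
Concordant x y x′ y′ = (x < x′ ⇔ y < y′) × (x′ < x ⇔ y′ < y)

-- A structural form of OrderIso (see ≅⇒OrderIso and OrderIso⇒≅) that splits along _++_.
infix 4 _≅_
data _≅_ : List ℕ → List ℕ → Set where
  []  : [] ≅ []
  _∷_ : ∀ {x y xs ys} → Pointwise (Concordant x y) xs ys → xs ≅ ys → x ∷ xs ≅ y ∷ ys

CrossConcordant : List ℕ → List ℕ → List ℕ → List ℕ → Set
CrossConcordant xs ys xs′ ys′ = Pointwise (λ x y → Pointwise (Concordant x y) xs′ ys′) xs ys

≅-length : xs ≅ ys → length xs ≡ length ys
≅-length []        = refl
≅-length (_ ∷ xs≅) = cong suc (≅-length xs≅)

≅-sym : xs ≅ ys → ys ≅ xs
≅-sym []          = []
≅-sym (row ∷ xs≅) = Pointwise.symmetric (λ (p , q) → FP.sym p , FP.sym q) row ∷ ≅-sym xs≅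

≅-trans : xs ≅ ys → ys ≅ zs → xs ≅ zs
≅-trans []          []          = []
≅-trans (row ∷ xs≅) (row′ ∷ ys≅) =
  Pointwise.transitive (λ (p , q) (p′ , q′) → FP.trans p p′ , FP.trans q q′) row row′ ∷ ≅-trans xs≅ ys≅

≅-++⁺ : ∀ {xs′ ys′} → xs ≅ ys → xs′ ≅ ys′ → CrossConcordant xs ys xs′ ys′ → xs ++ xs′ ≅ ys ++ ys′
≅-++⁺ []          xs′≅ []            = xs′≅
≅-++⁺ (row ∷ xs≅) xs′≅ (row′ ∷ cross) = Pointwise.++⁺ row row′ ∷ ≅-++⁺ xs≅ xs′≅ cross

≅-++⁻ : ∀ xs {xs′ w} → xs ++ xs′ ≅ w →
        ∃₂ λ ys ys′ → w ≡ ys ++ ys′ × xs ≅ ys × xs′ ≅ ys′ × CrossConcordant xs ys xs′ ys′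
≅-++⁻ []       xs′≅        = [] , _ , refl , [] , xs′≅ , []
≅-++⁻ (x ∷ xs) (row ∷ rest) with ys , ys′ , refl , xs≅ , xs′≅ , cross ← ≅-++⁻ xs rest =
  let rowL , rowR = pointwise-++⁻ (≅-length xs≅) row in
  _ ∷ ys , ys′ , refl , rowL ∷ xs≅ , xs′≅ , rowR ∷ cross

concordant-< : ∀ {x y x′ y′} → x < x′ → y < y′ → Concordant x y x′ y′
concordant-< x<x′ y<y′ = mk⇔ (λ _ → y<y′) (λ _ → x<x′) , mk⇔ (⊥-elim ∘ <-asym x<x′) (⊥-elim ∘ <-asym y<y′)

concordant-> : ∀ {x y x′ y′} → x′ < x → y′ < y → Concordant x y x′ y′
concordant-> x′<x y′<y = mk⇔ (⊥-elim ∘ <-asym x′<x) (⊥-elim ∘ <-asym y′<y) , mk⇔ (λ _ → y′<y) (λ _ → x′<x)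

module _ {xs ys xs′ ys′ : List ℕ} where

  cross-< : length xs ≡ length ys → length xs′ ≡ length ys′ → AllLess xs xs′ → AllLess ys ys′ →
            CrossConcordant xs ys xs′ ys′
  cross-< eq eq′ xs<xs′ ys<ys′ = pointwise-universal eq λ x∈ y∈ → pointwise-universal eq′ λ x′∈ y′∈ →
    concordant-< (xs<xs′ _ _ x∈ x′∈) (ys<ys′ _ _ y∈ y′∈)

  cross-> : length xs ≡ length ys → length xs′ ≡ length ys′ → AllLess xs′ xs → AllLess ys′ ys →
            CrossConcordant xs ys xs′ ys′
  cross-> eq eq′ xs′<xs ys′<ys = pointwise-universal eq λ x∈ y∈ → pointwise-universal eq′ λ x′∈ y′∈ →
    concordant-> (xs′<xs _ _ x′∈ x∈) (ys′<ys _ _ y′∈ y∈)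

  cross-<⁻ : CrossConcordant xs ys xs′ ys′ → AllLess xs xs′ → AllLess ys ys′
  cross-<⁻ cross xs<xs′ _ _ y∈ y′∈
    with x , x∈ , row ← pointwise-partner cross y∈
    with x′ , x′∈ , (x<x′⇔y<y′ , _) ← pointwise-partner row y′∈
    = Equivalence.to x<x′⇔y<y′ (xs<xs′ x x′ x∈ x′∈)

  cross->⁻ : CrossConcordant xs ys xs′ ys′ → AllLess xs′ xs → AllLess ys′ ys
  cross->⁻ cross xs′<xs _ _ y′∈ y∈
    with x , x∈ , row ← pointwise-partner cross y∈
    with x′ , x′∈ , (_ , x′<x⇔y′<y) ← pointwise-partner row y′∈
    = Equivalence.to x′<x⇔y′<y (xs′<xs x′ x x′∈ x∈)

≅-shift : ∀ k → xs ≅ ys → xs ≅ map (_+ k) ys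
≅-shift k []          = []
≅-shift k (row ∷ xs≅) = shift-row row ∷ ≅-shift k xs≅
  where
  <⇔+k< : ∀ {m n} → m < n ⇔ m + k < n + k
  <⇔+k< = mk⇔ (+-monoˡ-< k) (+-cancelʳ-< _ _ _)
  shift : ∀ {x y x′ y′} → Concordant x y x′ y′ → Concordant x (y + k) x′ (y′ + k)
  shift (p , q) = FP.trans p <⇔+k< , FP.trans q <⇔+k<
  shift-row : ∀ {x y xs ys} → Pointwise (Concordant x y) xs ys →
              Pointwise (Concordant x (y + k)) xs (map (_+ k) ys)
  shift-row []       = []
  shift-row (ρ ∷ ρs) = shift ρ ∷ shift-row ρs

≅⇒at : xs ≅ ys → ∀ l r → l < length ys → r < length ys →
       (at xs (suc l) < at xs (suc r)) ⇔ (at ys (suc l) < at ys (suc r))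
≅⇒at (_ ∷ _)     zero    zero    _   _   = mk⇔ (⊥-elim ∘ <-irrefl refl) (⊥-elim ∘ <-irrefl refl)
≅⇒at (row ∷ _)   zero    (suc r) _   r<n = proj₁ (pointwise-at⁺ row (s<s⁻¹ r<n))
≅⇒at (row ∷ _)   (suc l) zero    l<n _   = proj₂ (pointwise-at⁺ row (s<s⁻¹ l<n))
≅⇒at (_ ∷ xs≅)   (suc l) (suc r) l<n r<n = ≅⇒at xs≅ l r (s<s⁻¹ l<n) (s<s⁻¹ r<n)

at⇒≅ : length xs ≡ length ys →
       (∀ l r → l < length ys → r < length ys →
          (at xs (suc l) < at xs (suc r)) ⇔ (at ys (suc l) < at ys (suc r))) →
       xs ≅ ys
at⇒≅ {[]}    {[]}    _  _    = []
at⇒≅ {_ ∷ _} {_ ∷ _} eq same =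
    pointwise-at⁻ (suc-injective eq) (λ r r<n → same 0 (suc r) z<s (s<s r<n) , same (suc r) 0 (s<s r<n) z<s)
  ∷ at⇒≅ (suc-injective eq) (λ l r l<n r<n → same (suc l) (suc r) (s<s l<n) (s<s r<n))

≅⇒OrderIso : xs ≅ ys → OrderIso xs ys
≅⇒OrderIso {xs} {ys} xs≅ = ≅-length xs≅ , same
  where
  same : ∀ l r → 1 ≤ l → l ≤ length ys → 1 ≤ r → r ≤ length ys →
         (at xs l < at xs r) ⇔ (at ys l < at ys r)
  same (suc l) (suc r) _ l≤n _ r≤n = ≅⇒at xs≅ l r l≤n r≤n

OrderIso⇒≅ : OrderIso xs ys → xs ≅ ys
OrderIso⇒≅ (eq , same) = at⇒≅ eq (λ l r l<n r<n → same (suc l) (suc r) (s≤s z≤n) l<n (s≤s z≤n) r<n)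

IsPerm-bounds : ∀ {π} → IsPerm π → x ∈ π → x ∈[ 1 , length π ]
IsPerm-bounds π↭ x∈ = ∈-range⁻ (Perm.∈-resp-↭ π↭ x∈)

length-⊕ : ∀ π π′ → length (π ⊕ π′) ≡ length π + length π′
length-⊕ π π′ = trans (length-++ π) (cong (length π +_) (length-map _ π′))

length-⊖ : ∀ π π′ → length (π ⊖ π′) ≡ length π + length π′
length-⊖ π π′ = trans (length-++ (map _ π)) (cong (_+ length π′) (length-map _ π))

applyUpTo-+ : ∀ (f : ℕ → A) m n → applyUpTo f (m + n) ≡ applyUpTo f m ++ applyUpTo (f ∘ (m +_)) n
applyUpTo-+ f zero    n = refl
applyUpTo-+ f (suc m) n = cong (f 0 ∷_) (applyUpTo-+ (f ∘ suc) m n)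

range-1-+ : ∀ p q → range 1 (p + q) ≡ range 1 p ++ map (_+ p) (range 1 q)
range-1-+ p q = begin
  map suc (upTo (p + q))                            ≡⟨ map-upTo suc (p + q) ⟩
  applyUpTo suc (p + q)                             ≡⟨ applyUpTo-+ suc p q ⟩
  applyUpTo suc p ++ applyUpTo (suc ∘ (p +_)) q     ≡⟨ cong₂ _++_ (map-upTo suc p) shifted ⟨
  map suc (upTo p) ++ map (_+ p) (map suc (upTo q)) ∎
  where
  open ≡-Reasoning
  shifted : map (_+ p) (map suc (upTo q)) ≡ applyUpTo (suc ∘ (p +_)) q
  shifted = begin
    map (_+ p) (map suc (upTo q))    ≡⟨ map-∘ (upTo q) ⟨
    map (λ x → suc (x + p)) (upTo q) ≡⟨ map-cong (λ x → cong suc (+-comm x p)) (upTo q) ⟩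
    map (suc ∘ (p +_)) (upTo q)      ≡⟨ map-upTo (suc ∘ (p +_)) q ⟩
    applyUpTo (suc ∘ (p +_)) q       ∎

IsPerm-⊕ : ∀ {π π′} → IsPerm π → IsPerm π′ → IsPerm (π ⊕ π′)
IsPerm-⊕ {π} {π′} π↭ π′↭ = begin
  π ++ map (_+ p) π′                              ↭⟨ Perm.++⁺ π↭ (Perm.map⁺ _ π′↭) ⟩
  range 1 p ++ map (_+ p) (range 1 (length π′))   ≡⟨ range-1-+ p (length π′) ⟨
  range 1 (p + length π′)                         ≡⟨ cong (range 1) (length-⊕ π π′) ⟨
  range 1 (length (π ⊕ π′))                       ∎
  where
  open PermutationReasoning
  p = length π

IsPerm-⊖ : ∀ {π π′} → IsPerm π → IsPerm π′ → IsPerm (π ⊖ π′)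
IsPerm-⊖ {π} {π′} π↭ π′↭ = begin
  map (_+ q) π ++ π′                              ↭⟨ Perm.++⁺ (Perm.map⁺ _ π↭) π′↭ ⟩
  map (_+ q) (range 1 p) ++ range 1 q             ↭⟨ Perm.++-comm (map (_+ q) (range 1 p)) (range 1 q) ⟩
  range 1 q ++ map (_+ q) (range 1 p)             ≡⟨ range-1-+ q p ⟨
  range 1 (q + p)                                 ≡⟨ cong (range 1) (trans (+-comm q p) (sym (length-⊖ π π′))) ⟩
  range 1 (length (π ⊖ π′))                       ∎
  where
  open PermutationReasoning
  p = length π
  q = length π′

shifted-above : ∀ {π π′} → IsPerm π → IsPerm π′ → AllLess π (map (_+ length π) π′)
shifted-above {π} π↭ π′↭ x _ x∈ y∈ with y , y∈π′ , refl ← ∈-map⁻ (_+ length π) y∈ =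
  ≤-trans (s≤s (proj₂ (IsPerm-bounds π↭ x∈))) (+-monoˡ-≤ (length π) (proj₁ (IsPerm-bounds π′↭ y∈π′)))

≅-⊕ : ∀ {π π′ xs xs′} → IsPerm π → IsPerm π′ → xs ≅ π → xs′ ≅ π′ → AllLess xs xs′ → xs ++ xs′ ≅ π ⊕ π′
≅-⊕ {π} {π′} π↭ π′↭ xs≅ xs′≅ xs<xs′ =
  ≅-++⁺ xs≅ (≅-shift _ xs′≅)
    (cross-< (≅-length xs≅) (trans (≅-length xs′≅) (sym (length-map _ π′))) xs<xs′ (shifted-above π↭ π′↭))

≅-⊖ : ∀ {π π′ xs xs′} → IsPerm π → IsPerm π′ → xs ≅ π → xs′ ≅ π′ → AllLess xs′ xs → xs ++ xs′ ≅ π ⊖ π′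
≅-⊖ {π} {π′} π↭ π′↭ xs≅ xs′≅ xs′<xs =
  ≅-++⁺ (≅-shift _ xs≅) xs′≅
    (cross-> (trans (≅-length xs≅) (sym (length-map _ π))) (≅-length xs′≅) xs′<xs (shifted-above π′↭ π↭))

map-at-range : ∀ τ → map (at τ) (range 1 (length τ)) ≡ τ
map-at-range τ = begin
  map (at τ) (map suc (upTo (length τ))) ≡⟨ map-∘ (upTo (length τ)) ⟨
  map (at τ ∘ suc) (upTo (length τ))     ≡⟨ map-upTo (at τ ∘ suc) (length τ) ⟩
  applyUpTo (at τ ∘ suc) (length τ)      ≡⟨ applyUpTo-at τ ⟩
  τ                                      ∎
  where
  open ≡-Reasoning
  applyUpTo-at : ∀ τ → applyUpTo (at τ ∘ suc) (length τ) ≡ τ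
  applyUpTo-at []      = refl
  applyUpTo-at (y ∷ τ) = cong (y ∷_) (applyUpTo-at τ)

module Occurrences (τ : List ℕ) where

  values : List ℕ → List ℕ
  values = map (at τ)

  record Occurrence (i j a b : ℕ) (ps : List ℕ) : Set where
    constructor occurrence
    field
      increasing : Increasing ps
      positions∈ : All (_∈[ i , j ]) ps
      values∈    : All (_∈[ a , b ]) (values ps)

  open Occurrence public

  occurrence-++⁺ : ∀ {i j a b psL psR} → Increasing psL → Increasing psR → AllLess psL psR →
                   All (_∈[ i , j ]) psL → All (_∈[ i , j ]) psR →
                   All (_∈[ a , b ]) (values psL) → All (_∈[ a , b ]) (values psR) →
                   Occurrence i j a b (psL ++ psR)
  occurrence-++⁺ {psL = psL} {psR} psL↑ psR↑ psL<psR psL∈ psR∈ vL∈ vR∈ = occurrence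
    (Increasing-++⁺ psL↑ psR↑ psL<psR)
    (All.++⁺ psL∈ psR∈)
    (subst (All _) (sym (map-++ (at τ) psL psR)) (All.++⁺ vL∈ vR∈))

  occurrence-++⁻ : ∀ {i j a b} psL {psR} → Occurrence i j a b (psL ++ psR) →
                   Increasing psL × Increasing psR × AllLess psL psR ×
                   All (_∈[ i , j ]) psL × All (_∈[ i , j ]) psR ×
                   All (_∈[ a , b ]) (values psL) × All (_∈[ a , b ]) (values psR)
  occurrence-++⁻ psL {psR} (occurrence ps↑ ps∈ vs∈) =
    let psL↑ , psR↑ , psL<psR = Increasing-++⁻ psL ps↑
        psL∈ , psR∈ = All.++⁻ psL ps∈
        vL∈ , vR∈ = All.++⁻ (values psL) (subst (All _) (map-++ (at τ) psL psR) vs∈)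
    in psL↑ , psR↑ , psL<psR , psL∈ , psR∈ , vL∈ , vR∈

  occurrence⇒⊆ : ∀ {a b ps} → Occurrence 1 (length τ) a b ps → values ps ⊆ τ
  occurrence⇒⊆ {ps = ps} occ = subst (values ps ⊆_) (map-at-range τ) (Sublist.map⁺ (at τ) ps⊆)
    where
    ps⊆ = Increasing⇒⊆ (increasing occ) (Increasing-range 1 (length τ)) (All.map ∈-range⁺ (positions∈ occ))

  ⊆⇒occurrence : ∀ {s} → IsPerm τ → s ⊆ τ →
                 ∃ λ ps → Occurrence 1 (length τ) 1 (length τ) ps × values ps ≡ s
  ⊆⇒occurrence τ↭ s⊆τ
    with ps , ps⊆ , refl ← ⊆-map⁻ (at τ) (range 1 (length τ)) (subst (_ ⊆_) (sym (map-at-range τ)) s⊆τ)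
    = ps
    , occurrence (Increasing-⊆ ps⊆ (Increasing-range 1 (length τ)))
                 (All.tabulate (∈-range⁻ ∘ Sublist.Any-resp-⊆ ps⊆))
                 (All.tabulate (IsPerm-bounds τ↭ ∘ Sublist.Any-resp-⊆ s⊆τ))
    , refl

∧-true⁻ : ∀ {p q} → p ∧ q ≡ true → p ≡ true × q ≡ true
∧-true⁻ {true} q≡true = refl , q≡true

≤ᵇ-true : ∀ {m n} → m ≤ n → (m ≤ᵇ n) ≡ true
≤ᵇ-true = Equivalence.to T-≡ ∘ ≤⇒≤ᵇ

≤ᵇ-true⁻ : ∀ {m n} → (m ≤ᵇ n) ≡ true → m ≤ n
≤ᵇ-true⁻ = ≤ᵇ⇒≤ _ _ ∘ Equivalence.from T-≡

module Correctness (Lg : List Pattern → Pattern) (longest : LongestSpec Lg) (τ : List ℕ) where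

  open Algorithm1 Lg τ
  open Occurrences τ

  CommonPattern : List ℕ → ℕ → ℕ → ℕ → ℕ → Pattern → Set
  CommonPattern s i j a b π =
    IsPerm π × (∃ λ u → u ⊆ s × u ≅ π) × (∃ λ ps → Occurrence i j a b ps × values ps ≅ π)

  Longest : Tree → List ℕ → Set
  Longest V s = ∀ {i j a b u ps} → 1 ≤ i → j ≤ n → 1 ≤ a → b ≤ n →
                u ⊆ s → Occurrence i j a b ps → u ≅ values ps → length u ≤ length (M V i j a b)

  candidate : Sign → Tree → Tree → ℕ → ℕ → ℕ → ℕ → ℕ → ℕ → Pattern
  candidate plus  L R i j a b h c = M L i (h ∸ 1) a (c ∸ 1) ⊕ M R h j c b
  candidate minus L R i j a b h c = M L i (h ∸ 1) c b ⊖ M R h j a (c ∸ 1)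

  candidates : Sign → Tree → Tree → ℕ → ℕ → ℕ → ℕ → List Pattern
  candidates sg L R i j a b =
    concatMap (λ h → map (candidate sg L R i j a b h) (range a (suc b))) (range i (suc j))

  ∈-candidates⁺ : ∀ sg L R {i j a b h c} → h ∈[ i , suc j ] → c ∈[ a , suc b ] →
                  candidate sg L R i j a b h c ∈ candidates sg L R i j a b
  ∈-candidates⁺ _ _ _ h∈ c∈ = ∈-concatMap⁺ _ (lose (∈-range⁺ h∈) (∈-map⁺ _ (∈-range⁺ c∈)))

  ∈-candidates⁻ : ∀ sg L R {i j a b π} → π ∈ candidates sg L R i j a b →
                  ∃₂ λ h c → h ∈[ i , suc j ] × c ∈[ a , suc b ] × π ≡ candidate sg L R i j a b h c
  ∈-candidates⁻ sg L R {i} {j} {a} {b} π∈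
    with h , h∈ , π∈row ← find (∈-concatMap⁻ _ π∈)
    with c , c∈ , refl ← ∈-map⁻ (candidate sg L R i j a b h) π∈row
    = h , c , ∈-range⁻ h∈ , ∈-range⁻ c∈ , refl

  chosen-candidate : ∀ sg L R {i j a b} → i ≤ suc j → a ≤ suc b →
                     ∃₂ λ h c → h ∈[ i , suc j ] × c ∈[ a , suc b ] ×
                                Lg (candidates sg L R i j a b) ≡ candidate sg L R i j a b h c
  chosen-candidate sg L R i≤1+j a≤1+b =
    ∈-candidates⁻ sg L R (proj₁ (longest _ (∈⇒≢[] (∈-candidates⁺ sg L R (≤-refl , i≤1+j) (≤-refl , a≤1+b)))))

  ≤-Lg : ∀ {S π} → π ∈ S → length π ≤ length (Lg S)
  ≤-Lg π∈ = proj₂ (longest _ (∈⇒≢[] π∈)) _ π∈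

  -- Verbatim the test M performs at a leaf.
  valueIn : ℕ → ℕ → ℕ → Bool
  valueIn a b h = (a ≤ᵇ at τ h) ∧ (at τ h ≤ᵇ b)

  T-valueIn : ∀ {a b h} → T (valueIn a b h) ⇔ at τ h ∈[ a , b ]
  T-valueIn = FP.trans T-∧ (mk⇔ (λ (p , q) → ≤ᵇ⇒≤ _ _ p , ≤ᵇ⇒≤ _ _ q) (λ (p , q) → ≤⇒≤ᵇ p , ≤⇒≤ᵇ q))

  valid⁺ : ∀ {i j a b} → 1 ≤ i → i ≤ j → j ≤ n → 1 ≤ a → a ≤ b → b ≤ n → valid i j a b ≡ true
  valid⁺ 1≤i i≤j j≤n 1≤a a≤b b≤n
    rewrite ≤ᵇ-true 1≤i | ≤ᵇ-true i≤j | ≤ᵇ-true j≤n | ≤ᵇ-true 1≤a | ≤ᵇ-true a≤b | ≤ᵇ-true b≤n = refl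

  valid⁻ : ∀ {i j a b} → valid i j a b ≡ true → 1 ≤ i × i ≤ j × j ≤ n × 1 ≤ a × a ≤ b × b ≤ n
  valid⁻ ev =
    let 1≤i , rest₁ = ∧-true⁻ ev
        i≤j , rest₂ = ∧-true⁻ rest₁
        j≤n , rest₃ = ∧-true⁻ rest₂
        1≤a , rest₄ = ∧-true⁻ rest₃
        a≤b , b≤n   = ∧-true⁻ rest₄
    in ≤ᵇ-true⁻ 1≤i , ≤ᵇ-true⁻ i≤j , ≤ᵇ-true⁻ j≤n , ≤ᵇ-true⁻ 1≤a , ≤ᵇ-true⁻ a≤b , ≤ᵇ-true⁻ b≤n

  ε-common : ∀ {s i j a b} → CommonPattern s i j a b ε
  ε-common = ↭-refl , ([] , minimum _ , []) , ([] , occurrence [] [] [] , [])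

  leaf-common : ∀ {s i j a b} → length s ≡ 1 →
                CommonPattern s i j a b (if any (valueIn a b) (range i j) then 1 ∷ [] else ε)
  leaf-common {x ∷ []} {i} {j} {a} {b} refl with any (valueIn a b) (range i j) in found
  ... | false = ε-common
  ... | true with h , h∈ , hit ← find (any⁻ _ (range i j) (Equivalence.from T-≡ found)) =
    ↭-refl , (x ∷ [] , ⊆-refl , [] ∷ []) ,
    (h ∷ [] , occurrence ([] ∷ []) (∈-range⁻ h∈ ∷ []) (Equivalence.to T-valueIn hit ∷ []) , [] ∷ [])

  ⊕-common : ∀ {sL sR i j a b h c πL πR} → AllLess sL sR →
             1 ≤ i → 1 ≤ a → h ∈[ i , suc j ] → c ∈[ a , suc b ] →
             CommonPattern sL i (h ∸ 1) a (c ∸ 1) πL → CommonPattern sR h j c b πR →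
             CommonPattern (sL ++ sR) i j a b (πL ⊕ πR)
  ⊕-common sL<sR 1≤i 1≤a h∈ c∈ (πL↭ , (uL , uL⊆ , uL≅) , (psL , occL , vL≅))
                               (πR↭ , (uR , uR⊆ , uR≅) , (psR , occR , vR≅))
    with psL∈ , psR∈ , psL<psR ← join-interval 1≤i h∈ (positions∈ occL) (positions∈ occR)
    with vL∈ , vR∈ , vL<vR ← join-interval 1≤a c∈ (values∈ occL) (values∈ occR)
    = IsPerm-⊕ πL↭ πR↭
    , (uL ++ uR , Sublist.++⁺ uL⊆ uR⊆ , ≅-⊕ πL↭ πR↭ uL≅ uR≅ (AllLess-⊆ sL<sR uL⊆ uR⊆))
    , (psL ++ psR , occurrence-++⁺ (increasing occL) (increasing occR) psL<psR psL∈ psR∈ vL∈ vR∈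
      , subst (_≅ _) (sym (map-++ (at τ) psL psR)) (≅-⊕ πL↭ πR↭ vL≅ vR≅ vL<vR))

  ⊖-common : ∀ {sL sR i j a b h c πL πR} → AllLess sR sL →
             1 ≤ i → 1 ≤ a → h ∈[ i , suc j ] → c ∈[ a , suc b ] →
             CommonPattern sL i (h ∸ 1) c b πL → CommonPattern sR h j a (c ∸ 1) πR →
             CommonPattern (sL ++ sR) i j a b (πL ⊖ πR)
  ⊖-common sR<sL 1≤i 1≤a h∈ c∈ (πL↭ , (uL , uL⊆ , uL≅) , (psL , occL , vL≅))
                               (πR↭ , (uR , uR⊆ , uR≅) , (psR , occR , vR≅))
    with psL∈ , psR∈ , psL<psR ← join-interval 1≤i h∈ (positions∈ occL) (positions∈ occR)
    with vR∈ , vL∈ , vR<vL ← join-interval 1≤a c∈ (values∈ occR) (values∈ occL)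
    = IsPerm-⊖ πL↭ πR↭
    , (uL ++ uR , Sublist.++⁺ uL⊆ uR⊆ , ≅-⊖ πL↭ πR↭ uL≅ uR≅ (AllLess-⊆ sR<sL uR⊆ uL⊆))
    , (psL ++ psR , occurrence-++⁺ (increasing occL) (increasing occR) psL<psR psL∈ psR∈ vL∈ vR∈
      , subst (_≅ _) (sym (map-++ (at τ) psL psR)) (≅-⊖ πL↭ πR↭ vL≅ vR≅ vR<vL))

  M-common : ∀ V {s} → SepTreeFor V s → ∀ i j a b → CommonPattern s i j a b (M V i j a b)
  M-common leaf s≡1 i j a b with valid i j a b
  ... | false = ε-common
  ... | true  = leaf-common s≡1
  M-common (node plus L R) (sL , sR , refl , tL , tR , _ , sL<sR) i j a b with valid i j a b in ev
  ... | false = ε-common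
  ... | true
    with 1≤i , i≤j , _ , 1≤a , a≤b , _ ← valid⁻ ev
    with h , c , h∈ , c∈ , chosen ← chosen-candidate plus L R (m≤n⇒m≤1+n i≤j) (m≤n⇒m≤1+n a≤b)
    = subst (CommonPattern _ i j a b) (sym chosen)
        (⊕-common sL<sR 1≤i 1≤a h∈ c∈ (M-common L tL i (h ∸ 1) a (c ∸ 1)) (M-common R tR h j c b))
  M-common (node minus L R) (sL , sR , refl , tL , tR , _ , sR<sL) i j a b with valid i j a b in ev
  ... | false = ε-common
  ... | true
    with 1≤i , i≤j , _ , 1≤a , a≤b , _ ← valid⁻ ev
    with h , c , h∈ , c∈ , chosen ← chosen-candidate minus L R (m≤n⇒m≤1+n i≤j) (m≤n⇒m≤1+n a≤b)
    = subst (CommonPattern _ i j a b) (sym chosen)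
        (⊖-common sR<sL 1≤i 1≤a h∈ c∈ (M-common L tL i (h ∸ 1) c b) (M-common R tR h j a (c ∸ 1)))

  ⊕-longest : ∀ {L R sL sR i j a b u ps} → AllLess sL sR → Longest L sL → Longest R sR →
              1 ≤ i → j ≤ n → 1 ≤ a → b ≤ n → i ≤ j → a ≤ b →
              u ⊆ sL ++ sR → Occurrence i j a b ps → u ≅ values ps →
              length u ≤ length (Lg (candidates plus L R i j a b))
  ⊕-longest {L} {R} {sL} {sR} {i} {j} {a} {b} sL<sR longestL longestR 1≤i j≤n 1≤a b≤n i≤j a≤b u⊆ occ u≅
    with uL , uR , refl , uL⊆ , uR⊆ ← ⊆-++⁻ sL sR u⊆
    with wL , wR , ws≡ , uL≅ , uR≅ , cross ← ≅-++⁻ uL u≅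
    with psL , psR , refl , refl , refl ← map-++⁻ (at τ) _ wL ws≡
    with psL↑ , psR↑ , psL<psR , psL∈ , psR∈ , vL∈ , vR∈ ← occurrence-++⁻ psL occ
    with h , h∈@(i≤h , h≤1+j) , psL∈′ , psR∈′ ← cut-interval (m≤n⇒m≤1+n i≤j) psL∈ psR∈ psL<psR
    with c , c∈@(a≤c , c≤1+b) , vL∈′ , vR∈′ ← cut-interval (m≤n⇒m≤1+n a≤b) vL∈ vR∈
                                                  (cross-<⁻ cross (AllLess-⊆ sL<sR uL⊆ uR⊆))
    = begin
      length (uL ++ uR)                                     ≡⟨ length-++ uL ⟩
      length uL + length uR                                 ≤⟨ +-mono-≤ uL≤ uR≤ ⟩
      length (M L i (h ∸ 1) a (c ∸ 1)) + length (M R h j c b)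
        ≡⟨ length-⊕ (M L i (h ∸ 1) a (c ∸ 1)) (M R h j c b) ⟨
      length (candidate plus L R i j a b h c)               ≤⟨ ≤-Lg (∈-candidates⁺ plus L R h∈ c∈) ⟩
      length (Lg (candidates plus L R i j a b))             ∎
    where
    open ≤-Reasoning
    uL≤ = longestL 1≤i (≤-trans (∸-monoˡ-≤ 1 h≤1+j) j≤n) 1≤a (≤-trans (∸-monoˡ-≤ 1 c≤1+b) b≤n)
                   uL⊆ (occurrence psL↑ psL∈′ vL∈′) uL≅
    uR≤ = longestR (≤-trans 1≤i i≤h) j≤n (≤-trans 1≤a a≤c) b≤n
                   uR⊆ (occurrence psR↑ psR∈′ vR∈′) uR≅

  ⊖-longest : ∀ {L R sL sR i j a b u ps} → AllLess sR sL → Longest L sL → Longest R sR →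
              1 ≤ i → j ≤ n → 1 ≤ a → b ≤ n → i ≤ j → a ≤ b →
              u ⊆ sL ++ sR → Occurrence i j a b ps → u ≅ values ps →
              length u ≤ length (Lg (candidates minus L R i j a b))
  ⊖-longest {L} {R} {sL} {sR} {i} {j} {a} {b} sR<sL longestL longestR 1≤i j≤n 1≤a b≤n i≤j a≤b u⊆ occ u≅
    with uL , uR , refl , uL⊆ , uR⊆ ← ⊆-++⁻ sL sR u⊆
    with wL , wR , ws≡ , uL≅ , uR≅ , cross ← ≅-++⁻ uL u≅
    with psL , psR , refl , refl , refl ← map-++⁻ (at τ) _ wL ws≡
    with psL↑ , psR↑ , psL<psR , psL∈ , psR∈ , vL∈ , vR∈ ← occurrence-++⁻ psL occ
    with h , h∈@(i≤h , h≤1+j) , psL∈′ , psR∈′ ← cut-interval (m≤n⇒m≤1+n i≤j) psL∈ psR∈ psL<psR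
    with c , c∈@(a≤c , c≤1+b) , vR∈′ , vL∈′ ← cut-interval (m≤n⇒m≤1+n a≤b) vR∈ vL∈
                                                  (cross->⁻ cross (AllLess-⊆ sR<sL uR⊆ uL⊆))
    = begin
      length (uL ++ uR)                                     ≡⟨ length-++ uL ⟩
      length uL + length uR                                 ≤⟨ +-mono-≤ uL≤ uR≤ ⟩
      length (M L i (h ∸ 1) c b) + length (M R h j a (c ∸ 1))
        ≡⟨ length-⊖ (M L i (h ∸ 1) c b) (M R h j a (c ∸ 1)) ⟨
      length (candidate minus L R i j a b h c)              ≤⟨ ≤-Lg (∈-candidates⁺ minus L R h∈ c∈) ⟩
      length (Lg (candidates minus L R i j a b))            ∎
    where
    open ≤-Reasoning
    uL≤ = longestL 1≤i (≤-trans (∸-monoˡ-≤ 1 h≤1+j) j≤n) (≤-trans 1≤a a≤c) b≤n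
                   uL⊆ (occurrence psL↑ psL∈′ vL∈′) uL≅
    uR≤ = longestR (≤-trans 1≤i i≤h) j≤n 1≤a (≤-trans (∸-monoˡ-≤ 1 c≤1+b) b≤n)
                   uR⊆ (occurrence psR↑ psR∈′ vR∈′) uR≅

  occupied : ∀ {i j a b p ps} → Occurrence i j a b (p ∷ ps) → i ≤ j × a ≤ b
  occupied (occurrence _ ((i≤p , p≤j) ∷ _) ((a≤v , v≤b) ∷ _)) = ≤-trans i≤p p≤j , ≤-trans a≤v v≤b

  occupied-hit : ∀ {i j a b p ps} → Occurrence i j a b (p ∷ ps) → any (valueIn a b) (range i j) ≡ true
  occupied-hit (occurrence _ (p∈ ∷ _) (v∈ ∷ _)) =
    Equivalence.to T-≡ (any⁺ _ (lose (∈-range⁺ p∈) (Equivalence.from T-valueIn v∈)))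

  M-longest : ∀ V {s} → SepTreeFor V s → Longest V s
  M-longest _ _ {u = []} _ _ _ _ _ _ _ = z≤n
  M-longest leaf s≡1 {u = _ ∷ _} {_ ∷ _} 1≤i j≤n 1≤a b≤n u⊆ occ _
    with i≤j , a≤b ← occupied occ
    rewrite valid⁺ 1≤i i≤j j≤n 1≤a a≤b b≤n | occupied-hit occ
    = ≤-trans (Sublist.length-mono-≤ u⊆) (≤-reflexive s≡1)
  M-longest (node plus L R) (sL , sR , refl , tL , tR , _ , sL<sR) {u = _ ∷ _} {_ ∷ _}
            1≤i j≤n 1≤a b≤n u⊆ occ u≅
    with i≤j , a≤b ← occupied occ
    rewrite valid⁺ 1≤i i≤j j≤n 1≤a a≤b b≤n
    = ⊕-longest {L} {R} sL<sR (M-longest L tL) (M-longest R tR) 1≤i j≤n 1≤a b≤n i≤j a≤b u⊆ occ u≅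
  M-longest (node minus L R) (sL , sR , refl , tL , tR , _ , sR<sL) {u = _ ∷ _} {_ ∷ _}
            1≤i j≤n 1≤a b≤n u⊆ occ u≅
    with i≤j , a≤b ← occupied occ
    rewrite valid⁺ 1≤i i≤j j≤n 1≤a a≤b b≤n
    = ⊖-longest {L} {R} sR<sL (M-longest L tL) (M-longest R tR) 1≤i j≤n 1≤a b≤n i≤j a≤b u⊆ occ u≅

proposition3 : (Lg : List Pattern → Pattern) → LongestSpec Lg →
    (σ : List ℕ) → IsPerm σ → Separable σ →
    (T : Tree) → IsSeparatingTree T σ →
    (τ : List ℕ) → IsPerm τ →
    IsLongestCommonPattern (algorithm1 Lg T τ) σ τ
proposition3 Lg longest σ _ _ T T-sep τ τ↭
  with π↭ , (u , u⊆σ , u≅π) , (ps , occ , vs≅π)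
         ← Correctness.M-common Lg longest τ T T-sep 1 (length τ) 1 (length τ)
  = π↭ , (u , u⊆σ , ≅⇒OrderIso u≅π) , (values ps , occurrence⇒⊆ occ , ≅⇒OrderIso vs≅π) , longest-common
  where
  open Occurrences τ
  open Correctness Lg longest τ
  longest-common : ∀ π′ → IsPerm π′ → IsPatternOf π′ σ → IsPatternOf π′ τ →
                   length π′ ≤ length (algorithm1 Lg T τ)
  longest-common π′ _ (s₁ , s₁⊆σ , s₁≅π′) (s₂ , s₂⊆τ , s₂≅π′)
    with ps′ , occ′ , refl ← ⊆⇒occurrence τ↭ s₂⊆τ
    = subst (_≤ length (algorithm1 Lg T τ)) (proj₁ s₁≅π′)
        (M-longest T T-sep ≤-refl ≤-refl ≤-refl ≤-refl s₁⊆σ occ′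
          (≅-trans (OrderIso⇒≅ s₁≅π′) (≅-sym (OrderIso⇒≅ {ys = π′} s₂≅π′))))
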